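{- Let $k\ge 1$, let $R_1=\prod_{i=1}^{k}F_i$ where each $F_i$ is a field, and let $R_2=\mathbb{Z}_n$ where $n=p_1p_2\cdots p_k$ with $p_1,\dots,p_k$ distinct primes. Then $\mathcal{E}_{R_1}\cong\mathcal{E}_{R_2}\cong\mathbb{AIG}(R_2)$ (graph isomorphisms).
   Context: An ideal of a commutative ring $R$ with unity is essential if it has nonzero intersection with every nonzero ideal of $R$. The essential ideal graph $\mathcal{E}_{R}$ is the simple graph whose vertices are the nonzero proper ideals of $R$, distinct $\hat I,\hat J$ adjacent iff $\hat I+\hat J$ is essential. An ideal $I$ is annihilating if $IJ=0$ for some nonzero ideal $J$. The annihilating ideal graph $\mathbb{AIG}(R)$ is the simple graph whose vertices are the nonzero annihilating ideals of $R$, distinct $\hat I,\hat J$ adjacent iff $\hat I\hat J=0$. -}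

module Defs where

open import Level using (Level; _⊔_; 0ℓ) renaming (suc to lsuc)
open import Data.Nat as ℕ using (ℕ)
open import Data.Integer as ℤ using (ℤ; +_)
open import Data.Integer.Divisibility using () renaming (_∣_ to _∣ℤ_)
open import Data.Fin using (Fin; zero; suc)
open import Data.Product using (Σ; ∃; _×_; _,_)
open import Relation.Nullary using (¬_)
open import Relation.Unary using (Pred)
open import Relation.Binary using (Rel)
open import Function.Bundles using (_⇔_)
open import Algebra.Bundles using (CommutativeRing)
open import Algebra.Bundles.Raw using (RawRing)

record Field (c ℓ : Level) : Set (lsuc (c ⊔ ℓ)) where
  field
    commutativeRing : CommutativeRing c ℓ
  open CommutativeRing commutativeRing public
  field
    1≉0     : ¬ (1# ≈ 0#)
    inverse : ∀ x → ¬ (x ≈ 0#) → ∃ λ y → (x * y) ≈ 1#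

-- Simple graphs whose vertex type carries an equality (vertices are
-- ideals, compared extensionally), and graph isomorphisms.

record Graph (a b e : Level) : Set (lsuc (a ⊔ b ⊔ e)) where
  field
    Vertex : Set a
    _≐_    : Rel Vertex b
    Adj    : Rel Vertex e

record _≅ᴳ_ {a b e a' b' e'} (G : Graph a b e) (H : Graph a' b' e')
       : Set (a ⊔ b ⊔ e ⊔ a' ⊔ b' ⊔ e') where
  private
    module G = Graph G
    module H = Graph H
  field
    to         : G.Vertex → H.Vertex
    to-cong    : ∀ {x y} → x G.≐ y → to x H.≐ to y
    to-inj     : ∀ {x y} → to x H.≐ to y → x G.≐ y
    to-surj    : ∀ y → ∃ λ x → to x H.≐ y
    adj-pres   : ∀ x y → G.Adj x y ⇔ H.Adj (to x) (to y)

-- Ideals of a commutative ring (only the ring operations are used).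
-- Ideals are predicates on the carrier at level c ⊔ ℓ.

module IdealTheory {c ℓ} (R : RawRing c ℓ) where
  open RawRing R

  record IsIdeal (I : Pred Carrier (c ⊔ ℓ)) : Set (c ⊔ ℓ) where
    field
      ≈-closed : ∀ {x y} → x ≈ y → I x → I y
      0-mem    : I 0#
      +-closed : ∀ {x y} → I x → I y → I (x + y)
      *-closed : ∀ r {x} → I x → I (r * x)

  Ideal : Set (lsuc (c ⊔ ℓ))
  Ideal = Σ (Pred Carrier (c ⊔ ℓ)) IsIdeal

  _∈ᵢ_ : Carrier → Ideal → Set (c ⊔ ℓ)
  x ∈ᵢ (I , _) = I x

  _≐_ : Ideal → Ideal → Set (c ⊔ ℓ)
  I ≐ J = ∀ x → (x ∈ᵢ I) ⇔ (x ∈ᵢ J)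

  NonZero : Ideal → Set (c ⊔ ℓ)
  NonZero I = ¬ (∀ x → x ∈ᵢ I → x ≈ 0#)

  Proper : Ideal → Set (c ⊔ ℓ)
  Proper I = ¬ (∀ x → x ∈ᵢ I)

  _⊕_ : Ideal → Ideal → Pred Carrier (c ⊔ ℓ)
  I ⊕ J = λ x → ∃ λ a → ∃ λ b → (a ∈ᵢ I) × (b ∈ᵢ J) × (x ≈ a + b)

  data _⊛_ (I J : Ideal) : Pred Carrier (c ⊔ ℓ) where
    gen  : ∀ {x a b} → a ∈ᵢ I → b ∈ᵢ J → x ≈ a * b → (I ⊛ J) x
    zer  : ∀ {x} → x ≈ 0# → (I ⊛ J) x
    plus : ∀ {x y z} → (I ⊛ J) x → (I ⊛ J) y → z ≈ x + y → (I ⊛ J) z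
    mult : ∀ {x z} r → (I ⊛ J) x → z ≈ r * x → (I ⊛ J) z

  ProdZero : Ideal → Ideal → Set (c ⊔ ℓ)
  ProdZero I J = ∀ x → (I ⊛ J) x → x ≈ 0#

  Essential : Pred Carrier (c ⊔ ℓ) → Set (lsuc (c ⊔ ℓ))
  Essential K = ∀ (J : Ideal) → NonZero J → ¬ (∀ x → K x → x ∈ᵢ J → x ≈ 0#)

  Annihilating : Ideal → Set (lsuc (c ⊔ ℓ))
  Annihilating I = ∃ λ (J : Ideal) → NonZero J × ProdZero I J

  EVertex : Set (lsuc (c ⊔ ℓ))
  EVertex = Σ Ideal λ I → NonZero I × Proper I

  essentialIdealGraph : Graph (lsuc (c ⊔ ℓ)) (c ⊔ ℓ) (lsuc (c ⊔ ℓ))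
  essentialIdealGraph = record
    { Vertex = EVertex
    ; _≐_    = λ { (I , _) (J , _) → I ≐ J }
    ; Adj    = λ { (I , _) (J , _) → ¬ (I ≐ J) × Essential (I ⊕ J) }
    }

  AVertex : Set (lsuc (c ⊔ ℓ))
  AVertex = Σ Ideal λ I → NonZero I × Annihilating I

  annihilatingIdealGraph : Graph (lsuc (c ⊔ ℓ)) (c ⊔ ℓ) (c ⊔ ℓ)
  annihilatingIdealGraph = record
    { Vertex = AVertex
    ; _≐_    = λ { (I , _) (J , _) → I ≐ J }
    ; Adj    = λ { (I , _) (J , _) → ¬ (I ≐ J) × ProdZero I J }
    }

prodRing : ∀ {c ℓ} (k : ℕ) → (Fin k → Field c ℓ) → RawRing c ℓ
prodRing k F = record
  { Carrier = (i : Fin k) → Field.Carrier (F i)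
  ; _≈_     = λ x y → ∀ i → Field._≈_ (F i) (x i) (y i)
  ; _+_     = λ x y i → Field._+_ (F i) (x i) (y i)
  ; _*_     = λ x y i → Field._*_ (F i) (x i) (y i)
  ; -_      = λ x i → Field.-_ (F i) (x i)
  ; 0#      = λ i → Field.0# (F i)
  ; 1#      = λ i → Field.1# (F i)
  }

ℤmod : ℕ → RawRing 0ℓ 0ℓ
ℤmod n = record
  { Carrier = ℤ
  ; _≈_     = λ x y → (+ n) ∣ℤ (x ℤ.- y)
  ; _+_     = ℤ._+_
  ; _*_     = ℤ._*_
  ; -_      = ℤ.-_
  ; 0#      = + 0
  ; 1#      = + 1
  }

prodℕ : ∀ (k : ℕ) → (Fin k → ℕ) → ℕ
prodℕ ℕ.zero    p = 1
prodℕ (ℕ.suc k) p = p zero ℕ.* prodℕ k (λ i → p (suc i))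

E : ∀ {c ℓ} (R : RawRing c ℓ) → Graph (lsuc (c ⊔ ℓ)) (c ⊔ ℓ) (lsuc (c ⊔ ℓ))
E R = IdealTheory.essentialIdealGraph R

AIG : ∀ {c ℓ} (R : RawRing c ℓ) → Graph (lsuc (c ⊔ ℓ)) (c ⊔ ℓ) (c ⊔ ℓ)
AIG R = IdealTheory.annihilatingIdealGraph R

{-# OPTIONS --safe #-}
-- Both F₁ × ⋯ × F_k and ℤ_n with n = p₁ ⋯ p_k split as products of k fields, so an ideal I
-- is determined by its support: the set of coordinates at which some element of I is nonzero
-- (excluded middle makes the support a Boolean vector). Under this correspondence I + J is
-- essential iff the supports of I and J cover {1, …, k}, and IJ = 0 iff they are disjoint,
-- i.e. iff the complements of the supports cover. Hence all three graphs are isomorphic to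
-- the graph on the nonempty proper subsets of {1, …, k} in which two distinct subsets are
-- adjacent when their union is everything.
module Submission where

open import Defs
open import Level using (Level; _⊔_; 0ℓ; Lift; lift) renaming (suc to lsuc)
open import Data.Nat as ℕ using (ℕ; zero; suc; _≤_)
import Data.Nat.Properties as ℕ
open import Data.Nat.Divisibility as ℕ
  using (divides; 1∣_; ∣1⇒≡1; n∣m*n; m∣m*n; *-monoˡ-∣)
open import Data.Nat.Primality
  using (Prime; euclidsLemma; prime⇒irreducible; prime⇒nonTrivial)
open import Data.Nat.Coprimality as Coprime using (Coprime; coprime-divisor; coprime-Bézout)
open import Data.Nat.GCD using (module Bézout)
open import Data.Integer as ℤ using (ℤ; +_; -[1+_]; 0ℤ; 1ℤ; ∣_∣)
import Data.Integer.Properties as ℤ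
open import Data.Integer.Divisibility.Signed
  using (_∣_; divides; ∣ᵤ⇒∣; ∣⇒∣ᵤ; ∣-trans; ∣m∣n⇒∣m+n; ∣m∣n⇒∣m-n; ∣m⇒∣-m; ∣m⇒∣m*n; ∣n⇒∣m*n)
open import Data.Integer.Tactic.RingSolver using (solve-∀)
open import Data.Fin as Fin using (Fin)
open import Data.Fin.Properties using (_≟_; suc-injective; punchInᵢ≢i)
open import Data.Bool using (Bool; true; false; not)
open import Data.Bool.Properties using (not-¬; ¬-not; not-injective; not-involutive)
open import Data.Product as Product using (Σ; ∃; _×_; _,_; proj₁; proj₂)
open import Data.Product.Function.NonDependent.Propositional using (_×-⇔_)
open import Data.Sum as Sum using (_⊎_; inj₁; inj₂; [_,_]′)
open import Data.Empty using (⊥-elim)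
open import Data.Vec.Functional using (Vector; removeAt)
open import Function using (_∘_; id)
open import Function.Bundles using (_⇔_; mk⇔; Equivalence)
open import Function.Definitions using (Injective)
open import Function.Related.TypeIsomorphisms using (¬-cong-⇔)
import Function.Properties.Equivalence as ⇔
open import Relation.Nullary using (¬_; yes; no; does)
open import Relation.Nullary.Decidable using (dec-true; dec-false; does-⇔; decidable-stable)
open import Relation.Unary using (Pred)
open import Relation.Binary using (IsEquivalence; _Respects_; _Respects₂_)
open import Relation.Binary.PropositionalEquality as ≡
  using (_≡_; _≢_; _≗_; refl; cong; subst)
open import Algebra.Bundles using (CommutativeMonoid)
open import Algebra.Bundles.Raw using (RawRing)
open import Axiom.ExcludedMiddle using (ExcludedMiddle)
import Algebra.Definitions.RawMonoid as RawMonoidDefinitions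
import Algebra.Properties.CommutativeMonoid.Sum as CommutativeMonoidSum
import Relation.Binary.Reasoning.Setoid as SetoidReasoning

open Equivalence using (to; from)

private
  variable
    v ℓ₁ ℓ₂ v′ ℓ₁′ ℓ₂′ v″ ℓ₁″ ℓ₂″ : Level

≅ᴳ-trans : {G : Graph v ℓ₁ ℓ₂} {H : Graph v′ ℓ₁′ ℓ₂′} {K : Graph v″ ℓ₁″ ℓ₂″} →
           IsEquivalence (Graph._≐_ K) → G ≅ᴳ H → H ≅ᴳ K → G ≅ᴳ K
≅ᴳ-trans ≐-equiv φ ψ = record
  { to       = ψ.to ∘ φ.to
  ; to-cong  = λ x≐y → ψ.to-cong (φ.to-cong x≐y)
  ; to-inj   = λ ψφx≐ψφy → φ.to-inj (ψ.to-inj ψφx≐ψφy)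
  ; to-surj  = λ z → let (y , ψy≐z) = ψ.to-surj z
                         (x , φx≐y) = φ.to-surj y
                     in x , IsEquivalence.trans ≐-equiv (ψ.to-cong φx≐y) ψy≐z
  ; adj-pres = λ x y → ⇔.trans (φ.adj-pres x y) (ψ.adj-pres (φ.to x) (φ.to y))
  }
  where
  module φ = _≅ᴳ_ φ
  module ψ = _≅ᴳ_ ψ

≅ᴳ-sym : {G : Graph v ℓ₁ ℓ₂} {H : Graph v′ ℓ₁′ ℓ₂′} →
         IsEquivalence (Graph._≐_ H) → Graph.Adj H Respects₂ Graph._≐_ H →
         G ≅ᴳ H → H ≅ᴳ G
≅ᴳ-sym {G = G} {H} ≐-equiv (adj-respʳ , adj-respˡ) φ = record
  { to       = φ⁻¹
  ; to-cong  = λ y≐y′ → φ.to-inj (≐.trans (section _) (≐.trans y≐y′ (≐.sym (section _))))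
  ; to-inj   = λ φ⁻¹y≐φ⁻¹y′ →
                 ≐.trans (≐.sym (section _)) (≐.trans (φ.to-cong φ⁻¹y≐φ⁻¹y′) (section _))
  ; to-surj  = λ x → φ.to x , φ.to-inj (section (φ.to x))
  ; adj-pres = λ y y′ → mk⇔
      (λ adj → from (φ.adj-pres (φ⁻¹ y) (φ⁻¹ y′))
                 (adj-respˡ (≐.sym (section y)) (adj-respʳ (≐.sym (section y′)) adj)))
      (λ adj → adj-respˡ (section y)
                 (adj-respʳ (section y′) (to (φ.adj-pres (φ⁻¹ y) (φ⁻¹ y′)) adj)))
  }
  where
  module φ = _≅ᴳ_ φ
  module ≐ = IsEquivalence ≐-equiv
  φ⁻¹ : Graph.Vertex H → Graph.Vertex G
  φ⁻¹ y = proj₁ (φ.to-surj y)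
  section : ∀ y → Graph._≐_ H (φ.to (φ⁻¹ y)) y
  section y = proj₂ (φ.to-surj y)

Covers : ∀ {k} → (Fin k → Bool) → (Fin k → Bool) → Set
Covers S T = ∀ i → S i ≡ true ⊎ T i ≡ true

coveringGraph : ℕ → Graph 0ℓ 0ℓ 0ℓ
coveringGraph k = record
  { Vertex = Σ (Fin k → Bool) λ S → (∃ λ i → S i ≡ true) × (∃ λ i → S i ≡ false)
  ; _≐_    = λ S T → proj₁ S ≗ proj₁ T
  ; Adj    = λ S T → ¬ (proj₁ S ≗ proj₁ T) × Covers (proj₁ S) (proj₁ T)
  }

coveringGraph-≐-isEquivalence : ∀ k → IsEquivalence (Graph._≐_ (coveringGraph k))
coveringGraph-≐-isEquivalence k = record
  { refl  = λ _ → refl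
  ; sym   = λ S≗T i → ≡.sym (S≗T i)
  ; trans = λ S≗T T≗U i → ≡.trans (S≗T i) (T≗U i)
  }

coveringGraph-Adj-resp : ∀ k → Graph.Adj (coveringGraph k) Respects₂ Graph._≐_ (coveringGraph k)
coveringGraph-Adj-resp k =
  (λ T≗T′ (S≉T , cover) →
     (λ S≗T′ → S≉T (λ i → ≡.trans (S≗T′ i) (≡.sym (T≗T′ i)))) ,
     (λ i → Sum.map₂ (λ Ti → ≡.trans (≡.sym (T≗T′ i)) Ti) (cover i))) ,
  (λ S≗S′ (S≉T , cover) →
     (λ S′≗T → S≉T (λ i → ≡.trans (S≗S′ i) (S′≗T i))) ,
     (λ i → Sum.map₁ (λ Si → ≡.trans (≡.sym (S≗S′ i)) Si) (cover i)))

module _ {c ℓ} (R : RawRing c ℓ) where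
  open RawRing R
  open IdealTheory R
  open import Algebra.Definitions.RawMonoid +-rawMonoid using (sum)

  E-≐-isEquivalence : IsEquivalence (Graph._≐_ (E R))
  E-≐-isEquivalence = record
    { refl  = λ x → ⇔.refl
    ; sym   = λ I≐J x → ⇔.sym (I≐J x)
    ; trans = λ I≐J J≐K x → ⇔.trans (I≐J x) (J≐K x)
    }

  AIG-≐-isEquivalence : IsEquivalence (Graph._≐_ (AIG R))
  AIG-≐-isEquivalence = record
    { refl  = λ x → ⇔.refl
    ; sym   = λ I≐J x → ⇔.sym (I≐J x)
    ; trans = λ I≐J J≐K x → ⇔.trans (I≐J x) (J≐K x)
    }

  sum-∈ : ∀ (I : Ideal) {n} (t : Vector Carrier n) → (∀ i → t i ∈ᵢ I) → sum t ∈ᵢ I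
  sum-∈ I {zero}  t t∈I = IsIdeal.0-mem (proj₂ I)
  sum-∈ I {suc n} t t∈I =
    IsIdeal.+-closed (proj₂ I) (t∈I Fin.zero) (sum-∈ I (t ∘ Fin.suc) (t∈I ∘ Fin.suc))

  -- R presented as a product of k fields: Vanishes i x means that the i-th component of x
  -- is 0, and e i is the i-th unit vector. RawRing has no laws, so the four it needs are
  -- fields as well.
  record FieldDecomposition (k : ℕ) : Set (c ⊔ lsuc ℓ) where
    field
      ≈-refl      : ∀ {x} → x ≈ x
      ≈-sym       : ∀ {x y} → x ≈ y → y ≈ x
      +-identityˡ : ∀ x → 0# + x ≈ x
      +-identityʳ : ∀ x → x + 0# ≈ x

      Vanishes               : Fin k → Pred Carrier ℓ
      vanishes-resp          : ∀ {i} → Vanishes i Respects _≈_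
      vanishes-0             : ∀ {i} → Vanishes i 0#
      vanishes-+             : ∀ {i x y} → Vanishes i x → Vanishes i y → Vanishes i (x + y)
      vanishes-*ˡ            : ∀ {i} x y → Vanishes i x → Vanishes i (x * y)
      vanishes-*ʳ            : ∀ {i} x y → Vanishes i y → Vanishes i (x * y)
      vanishes-prime         : ∀ {i} x y → Vanishes i (x * y) → Vanishes i x ⊎ Vanishes i y
      vanishes-everywhere⇒≈0 : ∀ {x} → (∀ i → Vanishes i x) → x ≈ 0#

      e               : Fin k → Carrier
      e-vanishes      : ∀ {i j} → j ≢ i → Vanishes j (e i)
      e-nonvanishing  : ∀ i → ¬ Vanishes i (e i)
      e-multiple      : ∀ {i x} → ¬ Vanishes i x → ∃ λ a → a * x ≈ e i
      e-decomposition : ∀ x → sum (λ i → x * e i) ≈ x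

module IdealSupport {c ℓ} (em : ∀ {a} → ExcludedMiddle a) {R : RawRing c ℓ} {k : ℕ}
                    (D : FieldDecomposition R k) where
  open RawRing R
  open IdealTheory R
  open FieldDecomposition D

  NonvanishingAt : Ideal → Fin k → Set (c ⊔ ℓ)
  NonvanishingAt I i = ∃ λ x → x ∈ᵢ I × ¬ Vanishes i x

  support : Ideal → Fin k → Bool
  support I i = does (em {P = NonvanishingAt I i})

  ≈0⇒vanishes : ∀ {i x} → x ≈ 0# → Vanishes i x
  ≈0⇒vanishes x≈0 = vanishes-resp (≈-sym x≈0) vanishes-0

  vanishes-everywhere⇒∈ : ∀ (I : Ideal) {x} → (∀ i → Vanishes i x) → x ∈ᵢ I
  vanishes-everywhere⇒∈ I v =
    IsIdeal.≈-closed (proj₂ I) (≈-sym (vanishes-everywhere⇒≈0 v)) (IsIdeal.0-mem (proj₂ I))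

  *e-vanishes : ∀ {i x} → Vanishes i x → ∀ j → Vanishes j (x * e i)
  *e-vanishes {i} {x} v j with j ≟ i
  ... | yes refl = vanishes-*ˡ x (e i) v
  ... | no  j≢i  = vanishes-*ʳ x (e i) (e-vanishes j≢i)

  module _ (I : Ideal) (i : Fin k) where
    nonvanishing⇒support-true : ∀ {x} → x ∈ᵢ I → ¬ Vanishes i x → support I i ≡ true
    nonvanishing⇒support-true x∈I ¬v = dec-true em (_ , x∈I , ¬v)

    support-true : support I i ≡ true → NonvanishingAt I i
    support-true s = decidable-stable em λ ¬nv → not-¬ s (dec-false em ¬nv)

    support-false⇒vanishes : support I i ≡ false → ∀ {x} → x ∈ᵢ I → Vanishes i x
    support-false⇒vanishes s x∈I =
      decidable-stable em λ ¬v → not-¬ (nonvanishing⇒support-true x∈I ¬v) s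

    support-true⇒e∈ : support I i ≡ true → e i ∈ᵢ I
    support-true⇒e∈ s =
      let (x , x∈I , ¬v) = support-true s
          (a , ax≈e)     = e-multiple ¬v
      in IsIdeal.≈-closed (proj₂ I) ax≈e (IsIdeal.*-closed (proj₂ I) a x∈I)

  vanishingOutside : (Fin k → Bool) → Ideal
  vanishingOutside S = (λ x → Lift c (∀ i → S i ≡ false → Vanishes i x)) , record
    { ≈-closed = λ x≈y (lift v) → lift λ i Si → vanishes-resp x≈y (v i Si)
    ; 0-mem    = lift λ _ _ → vanishes-0
    ; +-closed = λ (lift v) (lift w) → lift λ i Si → vanishes-+ (v i Si) (w i Si)
    ; *-closed = λ r (lift v) → lift λ i Si → vanishes-*ʳ r _ (v i Si)
    }

  support-vanishingOutside : ∀ S → support (vanishingOutside S) ≗ S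
  support-vanishingOutside S i with S i in Si
  ... | true  = nonvanishing⇒support-true (vanishingOutside S) i
                  (lift λ j Sj → e-vanishes λ { refl → not-¬ Si Sj }) (e-nonvanishing i)
  ... | false = dec-false em λ (x , lift v , ¬v) → ¬v (v i Si)

  vanishingOutside-cong : ∀ {S T} → S ≗ T → vanishingOutside S ≐ vanishingOutside T
  vanishingOutside-cong S≗T x =
    mk⇔ (λ (lift v) → lift λ i Ti → v i (≡.trans (S≗T i) Ti))
        (λ (lift v) → lift λ i Si → v i (≡.trans (≡.sym (S≗T i)) Si))

  -- x is the sum of its components x eᵢ, and those with i outside the support of I vanish
  vanishingOutside-support : ∀ I → vanishingOutside (support I) ≐ I
  vanishingOutside-support I x =
    mk⇔ vanishingOutside⇒∈ λ x∈I → lift λ i s → support-false⇒vanishes I i s x∈I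
    where
    component∈ : ∀ (v : ∀ i → support I i ≡ false → Vanishes i x) i → (x * e i) ∈ᵢ I
    component∈ v i with support I i in s
    ... | true  = IsIdeal.*-closed (proj₂ I) x (support-true⇒e∈ I i s)
    ... | false = vanishes-everywhere⇒∈ I (*e-vanishes (v i s))
    vanishingOutside⇒∈ : x ∈ᵢ vanishingOutside (support I) → x ∈ᵢ I
    vanishingOutside⇒∈ (lift v) =
      IsIdeal.≈-closed (proj₂ I) (e-decomposition x) (sum-∈ R I _ (component∈ v))

  support-cong : ∀ I J → I ≐ J → support I ≗ support J
  support-cong I J I≐J i = does-⇔ (mk⇔ (λ (x , x∈I , ¬v) → x , to (I≐J x) x∈I , ¬v)
                                        (λ (x , x∈J , ¬v) → x , from (I≐J x) x∈J , ¬v)) em em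

  support-injective : ∀ I J → support I ≗ support J → I ≐ J
  support-injective I J sI≗sJ x =
    ⇔.trans (⇔.sym (vanishingOutside-support I x))
            (⇔.trans (vanishingOutside-cong sI≗sJ x) (vanishingOutside-support J x))

  ≐⇔support-≗ : ∀ I J → I ≐ J ⇔ support I ≗ support J
  ≐⇔support-≗ I J = mk⇔ (support-cong I J) (support-injective I J)

  atom : Fin k → Ideal
  atom i = vanishingOutside (λ j → does (j ≟ i))

  support-atom-≢ : ∀ {i j} → j ≢ i → support (atom i) j ≡ false
  support-atom-≢ {i} {j} j≢i = ≡.trans (support-vanishingOutside _ j) (dec-false (j ≟ i) j≢i)

  nonZero⇔ : ∀ I → NonZero I ⇔ ∃ λ i → support I i ≡ true
  nonZero⇔ I = mk⇔
    (λ nz → decidable-stable em λ ¬∃ → nz λ x x∈I → vanishes-everywhere⇒≈0 λ i →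
              support-false⇒vanishes I i (¬-not λ s → ¬∃ (i , s)) x∈I)
    (λ (i , s) all≈0 →
       let (x , x∈I , ¬v) = support-true I i s in ¬v (≈0⇒vanishes (all≈0 x x∈I)))

  atom-nonZero : ∀ i → NonZero (atom i)
  atom-nonZero i = from (nonZero⇔ (atom i))
    (i , ≡.trans (support-vanishingOutside _ i) (dec-true (i ≟ i) refl))

  proper⇔ : ∀ I → Proper I ⇔ ∃ λ i → support I i ≡ false
  proper⇔ I = mk⇔
    (λ pr → decidable-stable em λ ¬∃ → pr λ x →
              to (vanishingOutside-support I x) (lift λ i s → ⊥-elim (¬∃ (i , s))))
    (λ (i , s) all → e-nonvanishing i (support-false⇒vanishes I i s (all (e i))))

  ⊕∩atom≈0 : ∀ I J i → support I i ≡ false → support J i ≡ false →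
             ∀ x → (I ⊕ J) x → x ∈ᵢ atom i → x ≈ 0#
  ⊕∩atom≈0 I J i sI sJ x (a , b , a∈I , b∈J , x≈a+b) (lift v) =
    vanishes-everywhere⇒≈0 vanishes-at
    where
    vanishes-at : ∀ j → Vanishes j x
    vanishes-at j with j ≟ i
    ... | yes refl = vanishes-resp (≈-sym x≈a+b)
                       (vanishes-+ (support-false⇒vanishes I i sI a∈I)
                                   (support-false⇒vanishes J i sJ b∈J))
    ... | no  j≢i  = v j (dec-false (j ≟ i) j≢i)

  essential⇔covers : ∀ I J → Essential (I ⊕ J) ⇔ Covers (support I) (support J)
  essential⇔covers I J = mk⇔ essential⇒covers covers⇒essential
    where
    essential⇒covers : Essential (I ⊕ J) → Covers (support I) (support J)
    essential⇒covers ess i with support I i in sI | support J i in sJ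
    ... | true  | _     = inj₁ refl
    ... | false | true  = inj₂ refl
    ... | false | false = ⊥-elim (ess (atom i) (atom-nonZero i) (⊕∩atom≈0 I J i sI sJ))

    e∈⊕ : ∀ {i} → support I i ≡ true ⊎ support J i ≡ true → (I ⊕ J) (e i)
    e∈⊕ {i} (inj₁ s) = e i , 0# , support-true⇒e∈ I i s , IsIdeal.0-mem (proj₂ J)
                     , ≈-sym (+-identityʳ (e i))
    e∈⊕ {i} (inj₂ s) = 0# , e i , IsIdeal.0-mem (proj₂ I) , support-true⇒e∈ J i s
                     , ≈-sym (+-identityˡ (e i))

    covers⇒essential : Covers (support I) (support J) → Essential (I ⊕ J)
    covers⇒essential cover K nzK meet≈0 =
      let (i , sK) = to (nonZero⇔ K) nzK
      in e-nonvanishing i (≈0⇒vanishes (meet≈0 (e i) (e∈⊕ (cover i)) (support-true⇒e∈ K i sK)))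

  Disjoint : (Fin k → Bool) → (Fin k → Bool) → Set
  Disjoint S T = ∀ i → S i ≡ false ⊎ T i ≡ false

  ⊛-vanishes : ∀ I J → Disjoint (support I) (support J) →
               ∀ {x} → (I ⊛ J) x → ∀ i → Vanishes i x
  ⊛-vanishes I J disjoint (gen {a = a} {b} a∈I b∈J x≈ab) i = vanishes-resp (≈-sym x≈ab)
    ([ (λ sI → vanishes-*ˡ a b (support-false⇒vanishes I i sI a∈I))
     , (λ sJ → vanishes-*ʳ a b (support-false⇒vanishes J i sJ b∈J)) ]′ (disjoint i))
  ⊛-vanishes I J disjoint (zer x≈0) i = ≈0⇒vanishes x≈0
  ⊛-vanishes I J disjoint (plus p q z≈x+y) i = vanishes-resp (≈-sym z≈x+y)
    (vanishes-+ (⊛-vanishes I J disjoint p i) (⊛-vanishes I J disjoint q i))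
  ⊛-vanishes I J disjoint (mult r p z≈rx) i = vanishes-resp (≈-sym z≈rx)
    (vanishes-*ʳ r _ (⊛-vanishes I J disjoint p i))

  prodZero⇔disjoint : ∀ I J → ProdZero I J ⇔ Disjoint (support I) (support J)
  prodZero⇔disjoint I J = mk⇔ prodZero⇒disjoint
    (λ disjoint x x∈IJ → vanishes-everywhere⇒≈0 (⊛-vanishes I J disjoint x∈IJ))
    where
    prodZero⇒disjoint : ProdZero I J → Disjoint (support I) (support J)
    prodZero⇒disjoint pz i with support I i in sI | support J i in sJ
    ... | false | _     = inj₁ refl
    ... | true  | false = inj₂ refl
    ... | true  | true  = ⊥-elim ([ e-nonvanishing i , e-nonvanishing i ]′
            (vanishes-prime (e i) (e i) (≈0⇒vanishes (pz _
              (gen (support-true⇒e∈ I i sI) (support-true⇒e∈ J i sJ) ≈-refl)))))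

  annihilating⇔ : ∀ I → Annihilating I ⇔ ∃ λ i → support I i ≡ false
  annihilating⇔ I = mk⇔
    (λ (J , nzJ , pz) → let (i , sJ) = to (nonZero⇔ J) nzJ in
       i , [ id , (λ sJ′ → ⊥-elim (not-¬ sJ sJ′)) ]′ (to (prodZero⇔disjoint I J) pz i))
    (λ (i , sI) →
       atom i , atom-nonZero i , from (prodZero⇔disjoint I (atom i)) (disjoint-atom sI))
    where
    disjoint-atom : ∀ {i} → support I i ≡ false → Disjoint (support I) (support (atom i))
    disjoint-atom {i} sI j with j ≟ i
    ... | yes refl = inj₁ sI
    ... | no  j≢i  = inj₂ (support-atom-≢ j≢i)

  E≅coveringGraph : E R ≅ᴳ coveringGraph k
  E≅coveringGraph = record
    { to       = λ (I , nz , pr) → support I , to (nonZero⇔ I) nz , to (proper⇔ I) pr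
    ; to-cong  = λ {x} {y} → support-cong (proj₁ x) (proj₁ y)
    ; to-inj   = λ {x} {y} → support-injective (proj₁ x) (proj₁ y)
    ; to-surj  = λ (S , (i , Si) , (j , Sj)) →
        ( vanishingOutside S
        , from (nonZero⇔ (vanishingOutside S)) (i , ≡.trans (support-vanishingOutside S i) Si)
        , from (proper⇔ (vanishingOutside S)) (j , ≡.trans (support-vanishingOutside S j) Sj))
        , support-vanishingOutside S
    ; adj-pres = λ (I , _) (J , _) → ¬-cong-⇔ (≐⇔support-≗ I J) ×-⇔ essential⇔covers I J
    }

  cosupport : Ideal → Fin k → Bool
  cosupport I = not ∘ support I

  AIG≅coveringGraph : AIG R ≅ᴳ coveringGraph k
  AIG≅coveringGraph = record
    { to       = λ (I , nz , an) →
        cosupport I , Product.map₂ (cong not) (to (annihilating⇔ I) an)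
                    , Product.map₂ (cong not) (to (nonZero⇔ I) nz)
    ; to-cong  = λ {x} {y} → to (≐⇔cosupport-≗ (proj₁ x) (proj₁ y))
    ; to-inj   = λ {x} {y} → from (≐⇔cosupport-≗ (proj₁ x) (proj₁ y))
    ; to-surj  = λ (S , (i , Si) , (j , Sj)) →
        ( vanishingOutside (not ∘ S)
        , from (nonZero⇔ (vanishingOutside (not ∘ S)))
               (j , ≡.trans (support-vanishingOutside _ j) (cong not Sj))
        , from (annihilating⇔ (vanishingOutside (not ∘ S)))
               (i , ≡.trans (support-vanishingOutside _ i) (cong not Si)))
        , λ i → ≡.trans (cong not (support-vanishingOutside _ i)) (not-involutive (S i))
    ; adj-pres = λ (I , _) (J , _) → ¬-cong-⇔ (≐⇔cosupport-≗ I J) ×-⇔ prodZero⇔covers I J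
    }
    where
    ≐⇔cosupport-≗ : ∀ I J → I ≐ J ⇔ cosupport I ≗ cosupport J
    ≐⇔cosupport-≗ I J = mk⇔ (λ I≐J i → cong not (support-cong I J I≐J i))
                            (λ c≗c → support-injective I J (not-injective ∘ c≗c))
    prodZero⇔covers : ∀ I J → ProdZero I J ⇔ Covers (cosupport I) (cosupport J)
    prodZero⇔covers I J = ⇔.trans (prodZero⇔disjoint I J)
      (mk⇔ (λ disjoint i → Sum.map (cong not) (cong not) (disjoint i))
           (λ cover i → Sum.map not-injective not-injective (cover i)))

module _ {a ℓ} (M : CommutativeMonoid a ℓ) where
  open CommutativeMonoid M
  open CommutativeMonoidSum M using (sum; sum-remove; sum-cong-≋; sum-replicate-zero)
  open SetoidReasoning setoid

  sum-concentrated : ∀ {n} (t : Vector Carrier n) j → (∀ i → i ≢ j → t i ≈ ε) → sum t ≈ t j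
  sum-concentrated {suc n} t j t≈ε = begin
    sum t                    ≈⟨ sum-remove t ⟩
    t j ∙ sum (removeAt t j) ≈⟨ ∙-congˡ (sum-cong-≋ (λ i → t≈ε _ (punchInᵢ≢i j i))) ⟩
    t j ∙ sum {n} (λ _ → ε)  ≈⟨ ∙-congˡ (sum-replicate-zero n) ⟩
    t j ∙ ε                  ≈⟨ identityʳ (t j) ⟩
    t j                      ∎

module _ {c ℓ} (F : Field c ℓ) where
  open Field F
  open SetoidReasoning setoid

  x*y≈0⇒x≈0⊎y≈0 : ExcludedMiddle ℓ → ∀ {x y} → x * y ≈ 0# → x ≈ 0# ⊎ y ≈ 0#
  x*y≈0⇒x≈0⊎y≈0 em {x} {y} xy≈0 with em {P = x ≈ 0#}
  ... | yes x≈0 = inj₁ x≈0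
  ... | no  x≉0 = let (x⁻¹ , xx⁻¹≈1) = inverse x x≉0 in inj₂ (begin
    y             ≈⟨ *-identityˡ y ⟨
    1# * y        ≈⟨ *-congʳ xx⁻¹≈1 ⟨
    (x * x⁻¹) * y ≈⟨ *-congʳ (*-comm x x⁻¹) ⟩
    (x⁻¹ * x) * y ≈⟨ *-assoc x⁻¹ x y ⟩
    x⁻¹ * (x * y) ≈⟨ *-congˡ xy≈0 ⟩
    x⁻¹ * 0#      ≈⟨ zeroʳ x⁻¹ ⟩
    0#            ∎)

module ProductOfFields {c ℓ} (em : ∀ {a} → ExcludedMiddle a) (k : ℕ) (F : Fin k → Field c ℓ) where
  private
    module F (i : Fin k) = Field (F i)
    module ∑ᴾ = RawMonoidDefinitions (RawRing.+-rawMonoid (prodRing k F))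
    module ∑ (j : Fin k) = CommutativeMonoidSum (F.+-commutativeMonoid j)
  open RawRing (prodRing k F) using (Carrier; _≈_; _*_)

  unit : (i : Fin k) → F.Carrier i → Carrier
  unit i y j with j ≟ i
  ... | yes refl = y
  ... | no  _    = F.0# j

  unit-≢ : ∀ {i j} y → j ≢ i → unit i y j ≡ F.0# j
  unit-≢ {i} {j} y j≢i with j ≟ i
  ... | yes j≡i = ⊥-elim (j≢i j≡i)
  ... | no  _   = refl

  unit-self : ∀ i y → unit i y i ≡ y
  unit-self i y with i ≟ i
  ... | yes refl = refl
  ... | no  i≢i  = ⊥-elim (i≢i refl)

  sum-at : ∀ {n} (t : Vector Carrier n) j → ∑ᴾ.sum t j ≡ ∑.sum j (λ i → t i j)
  sum-at {zero}  t j = refl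
  sum-at {suc n} t j = cong (F._+_ j (t Fin.zero j)) (sum-at (t ∘ Fin.suc) j)

  e : Fin k → Carrier
  e i = unit i (F.1# i)

  e-multiple : ∀ {i x} → ¬ F._≈_ i (x i) (F.0# i) → ∃ λ a → (a * x) ≈ e i
  e-multiple {i} {x} xᵢ≉0 = unit i (proj₁ xᵢ⁻¹) , coordinate
    where
    open Field (F i) using (trans; *-comm)
    xᵢ⁻¹ = F.inverse i (x i) xᵢ≉0
    coordinate : ∀ j → F._≈_ j (F._*_ j (unit i (proj₁ xᵢ⁻¹) j) (x j)) (e i j)
    coordinate j with j ≟ i
    ... | yes refl = trans (*-comm (proj₁ xᵢ⁻¹) (x i)) (proj₂ xᵢ⁻¹)
    ... | no  _    = F.zeroˡ j (x j)

  e-decomposition : ∀ x → ∑ᴾ.sum (λ i → x * e i) ≈ x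
  e-decomposition x j = begin
    ∑ᴾ.sum (λ i → x * e i) j     ≡⟨ sum-at (λ i → x * e i) j ⟩
    ∑.sum j (λ i → x j *ⱼ e i j) ≈⟨ sum-concentrated (F.+-commutativeMonoid j) _ j off-diagonal ⟩
    x j *ⱼ e j j                 ≡⟨ cong (x j *ⱼ_) (unit-self j 1#) ⟩
    x j *ⱼ 1#                    ≈⟨ *-identityʳ (x j) ⟩
    x j                          ∎
    where
    open Field (F j) hiding (_≈_; _*_)
    open Field (F j) using () renaming (_≈_ to _≈ⱼ_; _*_ to _*ⱼ_)
    open SetoidReasoning setoid
    off-diagonal : ∀ i → i ≢ j → (x j *ⱼ e i j) ≈ⱼ 0#
    off-diagonal i i≢j =
      trans (*-congˡ (reflexive (unit-≢ (F.1# i) (i≢j ∘ ≡.sym)))) (zeroʳ (x j))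

  fieldDecomposition : FieldDecomposition (prodRing k F) k
  fieldDecomposition = record
    { ≈-refl                 = λ j → F.refl j
    ; ≈-sym                  = λ x≈y j → F.sym j (x≈y j)
    ; +-identityˡ            = λ x j → F.+-identityˡ j (x j)
    ; +-identityʳ            = λ x j → F.+-identityʳ j (x j)
    ; Vanishes               = λ i x → F._≈_ i (x i) (F.0# i)
    ; vanishes-resp          = λ {i} x≈y xᵢ≈0 → F.trans i (F.sym i (x≈y i)) xᵢ≈0
    ; vanishes-0             = λ {i} → F.refl i
    ; vanishes-+             = λ {i} xᵢ≈0 yᵢ≈0 →
                                 F.trans i (F.+-cong i xᵢ≈0 yᵢ≈0) (F.+-identityʳ i (F.0# i))
    ; vanishes-*ˡ            = λ {i} x y xᵢ≈0 → F.trans i (F.*-congʳ i xᵢ≈0) (F.zeroˡ i (y i))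
    ; vanishes-*ʳ            = λ {i} x y yᵢ≈0 → F.trans i (F.*-congˡ i yᵢ≈0) (F.zeroʳ i (x i))
    ; vanishes-prime         = λ {i} x y → x*y≈0⇒x≈0⊎y≈0 (F i) em
    ; vanishes-everywhere⇒≈0 = λ xᵢ≈0 → xᵢ≈0
    ; e                      = e
    ; e-vanishes             = λ {i} {j} j≢i → F.reflexive j (unit-≢ (F.1# i) j≢i)
    ; e-nonvanishing         = λ i eᵢᵢ≈0 →
                                 F.1≉0 i (F.trans i (F.reflexive i (≡.sym (unit-self i (F.1# i))))
                                                    eᵢᵢ≈0)
    ; e-multiple             = e-multiple
    ; e-decomposition        = e-decomposition
    }

prime≢1 : ∀ {q} → Prime q → q ≢ 1
prime≢1 q-prime = ℕ.nonTrivial⇒≢1 {{prime⇒nonTrivial q-prime}}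

prime∣prime⇒≡ : ∀ {q r} → Prime q → Prime r → q ℕ.∣ r → q ≡ r
prime∣prime⇒≡ q-prime r-prime q∣r =
  [ (λ q≡1 → ⊥-elim (prime≢1 q-prime q≡1)) , id ]′ (prime⇒irreducible r-prime q∣r)

prime∤⇒coprime : ∀ {q a} → Prime q → ¬ q ℕ.∣ a → Coprime q a
prime∤⇒coprime q-prime q∤a (d∣q , d∣a) with prime⇒irreducible q-prime d∣q
... | inj₁ d≡1  = d≡1
... | inj₂ refl = ⊥-elim (q∤a d∣a)

∣prodℕ : ∀ k (f : Fin k → ℕ) j → f j ℕ.∣ prodℕ k f
∣prodℕ (suc k) f Fin.zero    = m∣m*n (prodℕ k (f ∘ Fin.suc))
∣prodℕ (suc k) f (Fin.suc j) = ℕ.∣-trans (∣prodℕ k (f ∘ Fin.suc) j) (n∣m*n (f Fin.zero))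

prime∣prodℕ : ∀ {q} k (f : Fin k → ℕ) → Prime q → q ℕ.∣ prodℕ k f → ∃ λ j → q ℕ.∣ f j
prime∣prodℕ zero    f q-prime q∣1 = ⊥-elim (prime≢1 q-prime (∣1⇒≡1 q∣1))
prime∣prodℕ (suc k) f q-prime q∣prod
  with euclidsLemma (f Fin.zero) (prodℕ k (f ∘ Fin.suc)) q-prime q∣prod
... | inj₁ q∣f₀   = Fin.zero , q∣f₀
... | inj₂ q∣rest = let (j , q∣fⱼ₊₁) = prime∣prodℕ k (f ∘ Fin.suc) q-prime q∣rest
                    in Fin.suc j , q∣fⱼ₊₁

distinctPrimes⇒prodℕ∣ : ∀ k (p : Fin k → ℕ) → (∀ i → Prime (p i)) → Injective _≡_ _≡_ p →
                        ∀ {m} → (∀ i → p i ℕ.∣ m) → prodℕ k p ℕ.∣ m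
distinctPrimes⇒prodℕ∣ zero    p p-prime p-injective {m} p∣m = 1∣ m
distinctPrimes⇒prodℕ∣ (suc k) p p-prime p-injective {m} p∣m
  with distinctPrimes⇒prodℕ∣ k (p ∘ Fin.suc) (p-prime ∘ Fin.suc) (suc-injective ∘ p-injective)
                              (p∣m ∘ Fin.suc)
... | divides q m≡q*rest =
  subst (prodℕ (suc k) p ℕ.∣_) (≡.sym m≡q*rest) (*-monoˡ-∣ rest p₀∣q)
  where
  p₀ = p Fin.zero
  rest = prodℕ k (p ∘ Fin.suc)
  p₀∤rest : ¬ p₀ ℕ.∣ rest
  p₀∤rest p₀∣rest with prime∣prodℕ k (p ∘ Fin.suc) (p-prime Fin.zero) p₀∣rest
  ... | j , p₀∣pⱼ with p-injective (prime∣prime⇒≡ (p-prime Fin.zero) (p-prime (Fin.suc j)) p₀∣pⱼ)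
  ... | ()
  p₀∣q : p₀ ℕ.∣ q
  p₀∣q = coprime-divisor (prime∤⇒coprime (p-prime Fin.zero) p₀∤rest)
           (subst (p₀ ℕ.∣_) (≡.trans m≡q*rest (ℕ.*-comm q rest)) (p∣m Fin.zero))

module _ where
  open import Data.Integer using (_+_; _*_; _-_; -_)
  open import Algebra.Properties.CommutativeMonoid.Sum ℤ.+-0-commutativeMonoid
    using (sum; sum-remove)

  ∣0ℤ : ∀ {d} → d ∣ 0ℤ
  ∣0ℤ = divides 0ℤ refl

  cast-Bézout : ∀ m n o r → 1 ℕ.+ m ℕ.* n ≡ o ℕ.* r → 1ℤ + + m * + n ≡ + o * + r
  cast-Bézout m n o r eq = begin
    1ℤ + + m * + n     ≡⟨ cong (λ z → 1ℤ + z) (ℤ.pos-* m n) ⟨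
    1ℤ + + (m ℕ.* n)   ≡⟨ ℤ.pos-+ 1 (m ℕ.* n) ⟨
    + (1 ℕ.+ m ℕ.* n)  ≡⟨ cong +_ eq ⟩
    + (o ℕ.* r)        ≡⟨ ℤ.pos-* o r ⟩
    + o * + r          ∎
    where open ≡.≡-Reasoning

  inverse-mod-prime-ℕ : ∀ {q a} → Prime q → ¬ q ℕ.∣ a → ∃ λ b → + q ∣ b * + a - 1ℤ
  inverse-mod-prime-ℕ {q} {a} q-prime q∤a
    with coprime-Bézout (Coprime.sym (prime∤⇒coprime q-prime q∤a))
  ... | Bézout.+- x y 1+yq≡xa = + x , divides (+ y) (begin
    + x * + a - 1ℤ         ≡⟨ cong (λ z → z - 1ℤ) (cast-Bézout y q x a 1+yq≡xa) ⟨
    (1ℤ + + y * + q) - 1ℤ  ≡⟨ 1+m-1≡m (+ y * + q) ⟩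
    + y * + q              ∎)
    where
    open ≡.≡-Reasoning
    1+m-1≡m : ∀ m → (1ℤ + m) - 1ℤ ≡ m
    1+m-1≡m = solve-∀
  ... | Bézout.-+ x y 1+xa≡yq = - + x , divides (- + y) (begin
    - + x * + a - 1ℤ    ≡⟨ -m*n-1≡-[1+m*n] (+ x) (+ a) ⟩
    - (1ℤ + + x * + a)  ≡⟨ cong -_ (cast-Bézout x a y q 1+xa≡yq) ⟩
    - (+ y * + q)       ≡⟨ ℤ.neg-distribˡ-* (+ y) (+ q) ⟩
    - + y * + q         ∎)
    where
    open ≡.≡-Reasoning
    -m*n-1≡-[1+m*n] : ∀ m n → - m * n - 1ℤ ≡ - (1ℤ + m * n)
    -m*n-1≡-[1+m*n] = solve-∀

  inverse-mod-prime : ∀ {q} → Prime q → ∀ z → ¬ + q ∣ z → ∃ λ b → + q ∣ b * z - 1ℤ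
  inverse-mod-prime {q} q-prime (+ a) q∤a =
    inverse-mod-prime-ℕ q-prime (q∤a ∘ ∣ᵤ⇒∣ {+ q} {+ a})
  inverse-mod-prime {q} q-prime -[1+ a ] q∤-[1+a] =
    let (b , q∣b[1+a]-1) = inverse-mod-prime-ℕ q-prime (q∤-[1+a] ∘ ∣ᵤ⇒∣ {+ q} { -[1+ a ]})
    in - b , subst (+ q ∣_) (m*n-1≡-m*-n-1 b (+ suc a)) q∣b[1+a]-1
    where
    m*n-1≡-m*-n-1 : ∀ m n → m * n - 1ℤ ≡ - m * - n - 1ℤ
    m*n-1≡-m*-n-1 = solve-∀

  ∣-sum : ∀ {d n} (t : Vector ℤ n) → (∀ i → d ∣ t i) → d ∣ sum t
  ∣-sum {n = zero}  t d∣t = ∣0ℤ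
  ∣-sum {n = suc n} t d∣t = ∣m∣n⇒∣m+n (d∣t Fin.zero) (∣-sum (t ∘ Fin.suc) (d∣t ∘ Fin.suc))

  ∣sum-concentrated : ∀ {d n} (t : Vector ℤ n) j → (∀ i → i ≢ j → d ∣ t i) → d ∣ sum t - t j
  ∣sum-concentrated {d} {suc n} t j d∣t =
    subst (d ∣_) sum-removeAt≡sum-tⱼ (∣-sum (removeAt t j) (λ i → d∣t _ (punchInᵢ≢i j i)))
    where
    open ≡.≡-Reasoning
    m+n-m≡n : ∀ m n → (m + n) - m ≡ n
    m+n-m≡n = solve-∀
    sum-removeAt≡sum-tⱼ : sum (removeAt t j) ≡ sum t - t j
    sum-removeAt≡sum-tⱼ = begin
      sum (removeAt t j)                ≡⟨ m+n-m≡n (t j) (sum (removeAt t j)) ⟨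
      (t j + sum (removeAt t j)) - t j  ≡⟨ cong (λ s → s - t j) (sum-remove {i = j} t) ⟨
      sum t - t j                       ∎

  module SquarefreeModulus (k : ℕ) (p : Fin k → ℕ) (p-prime : ∀ i → Prime (p i))
                           (p-injective : Injective _≡_ _≡_ p) where
    n : ℕ
    n = prodℕ k p

    open RawRing (ℤmod n) using (_≈_)
    private module ∑ₙ = RawMonoidDefinitions (RawRing.+-rawMonoid (ℤmod n))

    Vanishes : Fin k → ℤ → Set
    Vanishes i x = + p i ∣ x

    ≈⇒vanishes : ∀ x y → x ≈ y → ∀ i → Vanishes i (x - y)
    ≈⇒vanishes x y x≈y i = ∣-trans (∣ᵤ⇒∣ {+ p i} {+ n} (∣prodℕ k p i)) (∣ᵤ⇒∣ {+ n} {x - y} x≈y)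

    vanishes⇒≈ : ∀ x y → (∀ i → Vanishes i (x - y)) → x ≈ y
    vanishes⇒≈ x y pᵢ∣x-y = distinctPrimes⇒prodℕ∣ k p p-prime p-injective (∣⇒∣ᵤ ∘ pᵢ∣x-y)

    ≡⇒≈ : ∀ {x y} → x ≡ y → x ≈ y
    ≡⇒≈ {x} refl = vanishes⇒≈ x x λ i → subst (+ p i ∣_) (≡.sym (ℤ.+-inverseʳ x)) ∣0ℤ

    omit : Fin k → Fin k → ℕ
    omit i j with j ≟ i
    ... | yes _ = 1
    ... | no  _ = p j

    cofactor : Fin k → ℕ
    cofactor i = prodℕ k (omit i)

    p∣cofactor : ∀ {i j} → j ≢ i → p j ℕ.∣ cofactor i
    p∣cofactor {i} {j} j≢i = subst (ℕ._∣ cofactor i) omitᵢⱼ≡pⱼ (∣prodℕ k (omit i) j)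
      where
      omitᵢⱼ≡pⱼ : omit i j ≡ p j
      omitᵢⱼ≡pⱼ with j ≟ i
      ... | yes j≡i = ⊥-elim (j≢i j≡i)
      ... | no  _   = refl

    p∤cofactor : ∀ i → ¬ p i ℕ.∣ cofactor i
    p∤cofactor i pᵢ∣cofactor =
      let (j , pᵢ∣omitᵢⱼ) = prime∣prodℕ k (omit i) (p-prime i) pᵢ∣cofactor in p∤omit j pᵢ∣omitᵢⱼ
      where
      p∤omit : ∀ j → ¬ p i ℕ.∣ omit i j
      p∤omit j pᵢ∣omit with j ≟ i
      ... | yes _   = prime≢1 (p-prime i) (∣1⇒≡1 pᵢ∣omit)
      ... | no  j≢i = j≢i (≡.sym (p-injective (prime∣prime⇒≡ (p-prime i) (p-prime j) pᵢ∣omit)))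

    cofactor⁻¹ : Fin k → ℤ
    cofactor⁻¹ i = proj₁ (inverse-mod-prime-ℕ (p-prime i) (p∤cofactor i))

    e : Fin k → ℤ
    e i = cofactor⁻¹ i * + cofactor i

    e≡1 : ∀ i → Vanishes i (e i - 1ℤ)
    e≡1 i = proj₂ (inverse-mod-prime-ℕ (p-prime i) (p∤cofactor i))

    e-vanishes : ∀ {i j} → j ≢ i → Vanishes j (e i)
    e-vanishes {i} j≢i = ∣n⇒∣m*n (cofactor⁻¹ i) (∣ᵤ⇒∣ {+ _} {+ cofactor i} (p∣cofactor j≢i))

    e-nonvanishing : ∀ i → ¬ Vanishes i (e i)
    e-nonvanishing i pᵢ∣eᵢ = prime≢1 (p-prime i)
      (∣1⇒≡1 (∣⇒∣ᵤ (subst (_ ∣_) (m-[m-1]≡1 (e i)) (∣m∣n⇒∣m-n pᵢ∣eᵢ (e≡1 i)))))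
      where
      m-[m-1]≡1 : ∀ m → m - (m - 1ℤ) ≡ 1ℤ
      m-[m-1]≡1 = solve-∀

    e-multiple : ∀ {i x} → ¬ Vanishes i x → ∃ λ a → a * x ≈ e i
    e-multiple {i} {x} pᵢ∤x =
      e i * b , vanishes⇒≈ (e i * b * x) (e i) λ j → subst (_ ∣_) (expand (e i) b x) (vanishes-at j)
      where
      x⁻¹ = inverse-mod-prime (p-prime i) x pᵢ∤x
      b = proj₁ x⁻¹
      vanishes-at : ∀ j → Vanishes j (e i * (b * x - 1ℤ))
      vanishes-at j with j ≟ i
      ... | yes refl = ∣n⇒∣m*n (e i) (proj₂ x⁻¹)
      ... | no  j≢i  = ∣m⇒∣m*n _ (e-vanishes j≢i)
      expand : ∀ u v w → u * (v * w - 1ℤ) ≡ u * v * w - u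
      expand = solve-∀

    e-decomposition : ∀ x → ∑ₙ.sum (λ i → x * e i) ≈ x
    e-decomposition x = vanishes⇒≈ (sum t) x λ j → subst (_ ∣_) (regroup (sum t) x (e j))
      (∣m∣n⇒∣m+n (∣sum-concentrated t j (λ i i≢j → ∣n⇒∣m*n x (e-vanishes (i≢j ∘ ≡.sym))))
                 (∣n⇒∣m*n x (e≡1 j)))
      where
      t : Vector ℤ k
      t i = x * e i
      regroup : ∀ s u v → (s - u * v) + u * (v - 1ℤ) ≡ s - u
      regroup = solve-∀

    fieldDecomposition : FieldDecomposition (ℤmod n) k
    fieldDecomposition = record
      { ≈-refl                 = λ {x} → ≡⇒≈ {x} refl
      ; ≈-sym                  = λ {x} {y} x≈y → vanishes⇒≈ y x λ i →
                                   subst (_ ∣_) (-[m-n]≡n-m x y) (∣m⇒∣-m (≈⇒vanishes x y x≈y i))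
      ; +-identityˡ            = λ x → ≡⇒≈ (ℤ.+-identityˡ x)
      ; +-identityʳ            = λ x → ≡⇒≈ (ℤ.+-identityʳ x)
      ; Vanishes               = Vanishes
      ; vanishes-resp          = λ {i} {x} {y} x≈y pᵢ∣x → subst (_ ∣_) (m-[m-n]≡n x y)
                                   (∣m∣n⇒∣m-n pᵢ∣x (≈⇒vanishes x y x≈y i))
      ; vanishes-0             = ∣0ℤ
      ; vanishes-+             = ∣m∣n⇒∣m+n
      ; vanishes-*ˡ            = λ x y → ∣m⇒∣m*n y
      ; vanishes-*ʳ            = λ x y → ∣n⇒∣m*n x
      ; vanishes-prime         = λ {i} x y pᵢ∣xy → Sum.map ∣ᵤ⇒∣ ∣ᵤ⇒∣
                                   (euclidsLemma ∣ x ∣ ∣ y ∣ (p-prime i)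
                                     (subst (p i ℕ.∣_) (ℤ.abs-* x y) (∣⇒∣ᵤ pᵢ∣xy)))
      ; vanishes-everywhere⇒≈0 = λ {x} pᵢ∣x → vanishes⇒≈ x 0ℤ λ i →
                                   subst (_ ∣_) (≡.sym (ℤ.+-identityʳ x)) (pᵢ∣x i)
      ; e                      = e
      ; e-vanishes             = e-vanishes
      ; e-nonvanishing         = e-nonvanishing
      ; e-multiple             = e-multiple
      ; e-decomposition        = e-decomposition
      }
      where
      -[m-n]≡n-m : ∀ m n → - (m - n) ≡ n - m
      -[m-n]≡n-m = solve-∀
      m-[m-n]≡n : ∀ m n → m - (m - n) ≡ n
      m-[m-n]≡n = solve-∀

mainTheorem3 : (∀ {a} → ExcludedMiddle a) →
    ∀ {c ℓ : Level} (k : ℕ) → 1 ≤ k →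
    (F : Fin k → Field c ℓ) →
    (p : Fin k → ℕ) → (∀ i → Prime (p i)) → Injective _≡_ _≡_ p →
    (E (prodRing k F) ≅ᴳ E (ℤmod (prodℕ k p)))
      × (E (ℤmod (prodℕ k p)) ≅ᴳ AIG (ℤmod (prodℕ k p)))
mainTheorem3 em k _ F p p-prime p-injective =
  ≅ᴳ-trans (E-≐-isEquivalence ℤₙ) ∏F.E≅coveringGraph (covering⁻¹ ℤₙ.E≅coveringGraph) ,
  ≅ᴳ-trans (AIG-≐-isEquivalence ℤₙ) ℤₙ.E≅coveringGraph (covering⁻¹ ℤₙ.AIG≅coveringGraph)
  where
  ℤₙ : RawRing 0ℓ 0ℓ
  ℤₙ = ℤmod (prodℕ k p)
  module ∏F = IdealSupport em (ProductOfFields.fieldDecomposition em k F)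
  module ℤₙ = IdealSupport em (SquarefreeModulus.fieldDecomposition k p p-prime p-injective)
  covering⁻¹ : ∀ {v ℓ₁ ℓ₂} {G : Graph v ℓ₁ ℓ₂} → G ≅ᴳ coveringGraph k → coveringGraph k ≅ᴳ G
  covering⁻¹ = ≅ᴳ-sym (coveringGraph-≐-isEquivalence k) (coveringGraph-Adj-resp k)
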